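{- Let $n$ be a positive integer and let $F=q(n;m_1;m_2;\dots;m_l)=\binom{[n]}{m_1}\cup\binom{[m_1-1]}{m_2}\cup\cdots\cup\binom{[m_{l-1}-1]}{m_l}$ for some positive integers $n\ge m_1>m_2>\cdots>m_l=1$. Then for any integers $s,t$ with $0\le s<t\le n$, $F$ can augment any subset of $[n]$ of size $s$ to some subset of $[n]$ of size $t$; that is, for every $S\subseteq[n]$ with $|S|=s$ there exist $A_1,\dots,A_k\in F$ such that $T=S\cup\bigcup_{i=1}^k A_i$ satisfies $|T|=t$.
   Context: $[n]=\{1,\dots,n\}$, and $\binom{S}{k}$ denotes the family of $k$-element subsets of a set $S$. -}

module Defs where

open import Data.Nat using (ℕ; zero; suc; _<_; _≤_; _∸_)
open import Data.Fin using (Fin; toℕ; inject₁; fromℕ) renaming (zero to fzero; suc to fsuc)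
open import Data.Fin.Subset using (Subset; _∈_; ∣_∣)
open import Data.Product using (Σ; _×_; ∃)
open import Data.Sum using (_⊎_)
open import Relation.Binary.PropositionalEquality using (_≡_)

-- Ground set [n] = {1,…,n} is represented by Fin n, with x : Fin n standing for toℕ x + 1.
-- Subsets of [n] are Data.Fin.Subset.Subset n.

SubsetOfInitial : {n : ℕ} → ℕ → Subset n → Set
SubsetOfInitial {n} k A = (x : Fin n) → x ∈ A → toℕ x < k

InBinom : {n : ℕ} → ℕ → ℕ → Subset n → Set
InBinom k r A = SubsetOfInitial k A × ∣ A ∣ ≡ r

-- The sequence m_1 > … > m_l is given as m : Fin (suc l) → ℕ with m fzero = m_1, m (fromℕ l) = m_l.
-- Membership in q(n; m_1; …; m_l) = binom([n],m_1) ∪ ⋃_{i} binom([m_i - 1], m_{i+1}).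
InQ : (n l : ℕ) → (Fin (suc l) → ℕ) → Subset n → Set
InQ n l m A = InBinom n (m fzero) A
            ⊎ Σ (Fin l) (λ i → InBinom (m (inject₁ i) ∸ 1) (m (fsuc i)) A)

-- Every family q(n; m₁; …; m_l) can add a single element to any proper
-- subset S of [n]; iterating this t − s times proves the theorem.  For the
-- single step let x be the least element missing from S and j the first
-- index with m_j − 1 ≤ x, which exists because m_l = 1.  The m_j-set
-- A = [m_j − 1] ∪ {x} lies in binom([n], m₁) if j = 1, and otherwise in
-- binom([m_{j−1} − 1], m_j) since x < m_{j−1} − 1 by minimality of j.  As
-- every element below x is already in S, S ∪ A = S ∪ {x}.
module Submission where

open import Defs
open import Data.Nat using (ℕ; zero; suc; _+_; _∸_; _<_; _≤_; z≤n; s≤s; _≤?_)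
open import Data.Nat.Properties
  using (≤-trans; <-≤-trans; <⇒≤; <⇒≱; ≰⇒>; +-suc; m≤n+m; m∸n+n≡m)
open import Data.Fin using (Fin; fromℕ; toℕ; inject; inject₁; fromℕ<)
  renaming (zero to fzero; suc to fsuc; _<_ to _<ᶠ_)
open import Data.Fin.Properties using (toℕ<n; toℕ-injective; toℕ-inject; toℕ-fromℕ<; ¬∀⟶∃¬-smallest)
open import Data.Fin.Subset using (Subset; ∣_∣; _∪_; ⋃; _∈_; _∉_; _⊆_; ⁅_⁆; ⊥; ⊤; inside; outside)
open import Data.Fin.Subset.Properties
  using (_∈?_; ∉⊥; ∣⊥∣≡0; ∣⊤∣≡n; p⊆q⇒∣p∣≤∣q∣; ⊆-antisym; p⊆p∪q; x∈p∪q⁻; x∈⁅y⁆⇒x≡y;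
         ∪-assoc; ∪-identityʳ)
open import Data.Vec using (_∷_; []; here; there)
open import Data.List using (List; []; _∷_)
open import Data.List.Relation.Unary.All using (All; []; _∷_)
open import Data.Product using (Σ; ∃; _×_; _,_)
open import Data.Sum using (_⊎_; inj₁; inj₂; [_,_])
open import Function using (id; _∘_)
open import Level using (Level)
open import Relation.Nullary using (¬_; yes; no; contradiction)
open import Relation.Unary using (Pred; Decidable)
open import Relation.Binary.PropositionalEquality using (_≡_; refl; cong; sym; trans; subst; module ≡-Reasoning)
open ≡-Reasoning

private
  variable
    ℓ : Level
    n : ℕ

first⊎crossing : ∀ l (P : Pred (Fin (suc l)) ℓ) → Decidable P → P (fromℕ l) →
                 P fzero ⊎ ∃ λ i → ¬ P (inject₁ i) × P (fsuc i)
first⊎crossing zero    P P? P-last = inj₁ P-last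
first⊎crossing (suc l) P P? P-last with P? fzero
... | yes P₀ = inj₁ P₀
... | no ¬P₀ = [ (λ P₁ → inj₂ (fzero , ¬P₀ , P₁)) , (λ { (i , crossing) → inj₂ (fsuc i , crossing) }) ]
                 (first⊎crossing l (P ∘ fsuc) (P? ∘ fsuc) P-last)

LeastMissing : Subset n → Fin n → Set
LeastMissing S x = x ∉ S × (∀ {y} → toℕ y < toℕ x → y ∈ S)

least-∉ : (S : Subset n) → ∣ S ∣ < n → ∃ (LeastMissing S)
least-∉ {n} S ∣S∣<n with ¬∀⟶∃¬-smallest n (_∈ S) (_∈? S) ¬all∈S
  where
  ¬all∈S : ¬ (∀ x → x ∈ S)
  ¬all∈S all∈S = <⇒≱ ∣S∣<n (subst (_≤ ∣ S ∣) (∣⊤∣≡n n) (p⊆q⇒∣p∣≤∣q∣ {p = ⊤} (λ {x} _ → all∈S x)))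
... | x , x∉S , below∈S = x , x∉S , λ {y} y<x →
  subst (_∈ S) (toℕ-injective (trans (toℕ-inject (fromℕ< y<x)) (toℕ-fromℕ< y<x))) (below∈S (fromℕ< y<x))

p⊆q⇒q∪p≡q : {p q : Subset n} → p ⊆ q → q ∪ p ≡ q
p⊆q⇒q∪p≡q {p = p} {q} p⊆q = ⊆-antisym (λ x∈q∪p → [ id , p⊆q ] (x∈p∪q⁻ q p x∈q∪p)) (p⊆p∪q p)

∣p∪⁅x⁆∣≡1+∣p∣ : (S : Subset n) {x : Fin n} → x ∉ S → ∣ S ∪ ⁅ x ⁆ ∣ ≡ suc ∣ S ∣
∣p∪⁅x⁆∣≡1+∣p∣ (inside  ∷ S) {fzero}  x∉S = contradiction here x∉S
∣p∪⁅x⁆∣≡1+∣p∣ (outside ∷ S) {fzero}  _   = cong (suc ∘ ∣_∣) (∪-identityʳ S)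
∣p∪⁅x⁆∣≡1+∣p∣ (inside  ∷ S) {fsuc x} x∉S = cong suc (∣p∪⁅x⁆∣≡1+∣p∣ S (x∉S ∘ there))
∣p∪⁅x⁆∣≡1+∣p∣ (outside ∷ S) {fsuc x} x∉S = ∣p∪⁅x⁆∣≡1+∣p∣ S (x∉S ∘ there)

initial : ℕ → Subset n
initial {zero}  _       = []
initial {suc n} zero    = ⊥
initial {suc n} (suc k) = inside ∷ initial k

∈initial⇒< : ∀ k {y : Fin n} → y ∈ initial k → toℕ y < k
∈initial⇒< {suc n} zero    y∈ = contradiction y∈ ∉⊥
∈initial⇒< {suc n} (suc k) {fzero}  _           = s≤s z≤n
∈initial⇒< {suc n} (suc k) {fsuc y} (there y∈) = s≤s (∈initial⇒< k y∈)

∣initial∣ : ∀ k → k ≤ n → ∣ initial {n} k ∣ ≡ k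
∣initial∣ {zero}  zero    _       = refl
∣initial∣ {suc n} zero    _       = ∣⊥∣≡0 n
∣initial∣ {suc n} (suc k) (s≤s k≤n) = cong suc (∣initial∣ k k≤n)

initialWith : ℕ → Fin n → Subset n
initialWith r x = initial (r ∸ 1) ∪ ⁅ x ⁆

initialWith-inBinom : ∀ {B r} (x : Fin n) → 1 ≤ r → r ∸ 1 ≤ toℕ x → toℕ x < B →
                      InBinom B r (initialWith r x)
initialWith-inBinom {n} {B} {suc k} x _ k≤x x<B = bounded , size
  where
  bounded : SubsetOfInitial B (initialWith (suc k) x)
  bounded y y∈A with x∈p∪q⁻ (initial k) ⁅ x ⁆ y∈A
  ... | inj₁ y∈initial = <-≤-trans (∈initial⇒< k y∈initial) (≤-trans k≤x (<⇒≤ x<B))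
  ... | inj₂ y∈⁅x⁆     = subst (λ z → toℕ z < B) (sym (x∈⁅y⁆⇒x≡y x y∈⁅x⁆)) x<B

  size : ∣ initialWith (suc k) x ∣ ≡ suc k
  size = begin
    ∣ initial {n} k ∪ ⁅ x ⁆ ∣ ≡⟨ ∣p∪⁅x⁆∣≡1+∣p∣ (initial k) (λ x∈ → <⇒≱ (∈initial⇒< k x∈) k≤x) ⟩
    suc ∣ initial {n} k ∣     ≡⟨ cong suc (∣initial∣ k (≤-trans k≤x (<⇒≤ (toℕ<n x)))) ⟩
    suc k                     ∎

∣p∪initialWith∣≡1+∣p∣ : {S : Subset n} {x : Fin n} → LeastMissing S x →
                  ∀ r → r ∸ 1 ≤ toℕ x → ∣ S ∪ initialWith r x ∣ ≡ suc ∣ S ∣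
∣p∪initialWith∣≡1+∣p∣ {S = S} {x} (x∉S , below∈S) r r∸1≤x = begin
  ∣ S ∪ (initial (r ∸ 1) ∪ ⁅ x ⁆) ∣ ≡⟨ cong ∣_∣ (sym (∪-assoc S _ _)) ⟩
  ∣ (S ∪ initial (r ∸ 1)) ∪ ⁅ x ⁆ ∣ ≡⟨ cong (λ T → ∣ T ∪ ⁅ x ⁆ ∣) (p⊆q⇒q∪p≡q initial⊆S) ⟩
  ∣ S ∪ ⁅ x ⁆ ∣                     ≡⟨ ∣p∪⁅x⁆∣≡1+∣p∣ S x∉S ⟩
  suc ∣ S ∣                         ∎
  where
  initial⊆S : initial (r ∸ 1) ⊆ S
  initial⊆S y∈ = below∈S (<-≤-trans (∈initial⇒< (r ∸ 1) y∈) r∸1≤x)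

binom-augmentsByOne : {S : Subset n} {x : Fin n} → LeastMissing S x →
                      ∀ {B r} → 1 ≤ r → r ∸ 1 ≤ toℕ x → toℕ x < B →
                      ∃ λ A → InBinom B r A × ∣ S ∪ A ∣ ≡ suc ∣ S ∣
binom-augmentsByOne {x = x} least {r = r} 1≤r r∸1≤x x<B =
  initialWith r x , initialWith-inBinom x 1≤r r∸1≤x x<B , ∣p∪initialWith∣≡1+∣p∣ least r r∸1≤x

AugmentsByOne : Pred (Subset n) ℓ → Set ℓ
AugmentsByOne {n} F = ∀ S → ∣ S ∣ < n → ∃ λ A → F A × ∣ S ∪ A ∣ ≡ suc ∣ S ∣

augmentsByOne⇒augments : {F : Pred (Subset n) ℓ} → AugmentsByOne F →
                         ∀ k S → k + ∣ S ∣ ≤ n → ∃ λ As → All F As × ∣ S ∪ ⋃ As ∣ ≡ k + ∣ S ∣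
augmentsByOne⇒augments step zero    S _ = [] , [] , cong ∣_∣ (∪-identityʳ S)
augmentsByOne⇒augments {n = n} step (suc k) S 1+k+∣S∣≤n
  with step S (≤-trans (s≤s (m≤n+m ∣ S ∣ k)) 1+k+∣S∣≤n)
... | A , FA , ∣S∪A∣≡1+∣S∣
  with augmentsByOne⇒augments step k (S ∪ A) k+∣S∪A∣≤n
  where
  k+∣S∪A∣≤n : k + ∣ S ∪ A ∣ ≤ n
  k+∣S∪A∣≤n = subst (λ c → k + c ≤ n) (sym ∣S∪A∣≡1+∣S∣) (subst (_≤ n) (sym (+-suc k ∣ S ∣)) 1+k+∣S∣≤n)
... | As , FAs , ∣S∪A∪As∣ = A ∷ As , FA ∷ FAs , (begin
  ∣ S ∪ (A ∪ ⋃ As) ∣ ≡⟨ cong ∣_∣ (sym (∪-assoc S A (⋃ As))) ⟩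
  ∣ (S ∪ A) ∪ ⋃ As ∣ ≡⟨ ∣S∪A∪As∣ ⟩
  k + ∣ S ∪ A ∣      ≡⟨ cong (k +_) ∣S∪A∣≡1+∣S∣ ⟩
  k + suc ∣ S ∣      ≡⟨ +-suc k ∣ S ∣ ⟩
  suc k + ∣ S ∣      ∎)

q-augmentsByOne : ∀ n l (m : Fin (suc l) → ℕ) → (∀ i → 1 ≤ m i) → m (fromℕ l) ≡ 1 →
                  AugmentsByOne (InQ n l m)
q-augmentsByOne n l m 1≤m m-last≡1 S ∣S∣<n with least-∉ S ∣S∣<n
... | x , least
  with first⊎crossing l (λ j → m j ∸ 1 ≤ toℕ x) (λ j → m j ∸ 1 ≤? toℕ x) last-fits
  where
  last-fits : m (fromℕ l) ∸ 1 ≤ toℕ x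
  last-fits rewrite m-last≡1 = z≤n
... | inj₁ m₁∸1≤x with binom-augmentsByOne least (1≤m fzero) m₁∸1≤x (toℕ<n x)
...   | A , A∈binom , ∣S∪A∣ = A , inj₁ A∈binom , ∣S∪A∣
q-augmentsByOne n l m 1≤m m-last≡1 S ∣S∣<n | x , least | inj₂ (i , mᵢ∸1≰x , mᵢ₊₁∸1≤x)
  with binom-augmentsByOne least (1≤m (fsuc i)) mᵢ₊₁∸1≤x (≰⇒> mᵢ∸1≰x)
...   | A , A∈binom , ∣S∪A∣ = A , inj₂ (i , A∈binom) , ∣S∪A∣

mainTheorem3 : (n l : ℕ) → (m : Fin (suc l) → ℕ) →
    1 ≤ n →
    (∀ i → 1 ≤ m i) →
    m fzero ≤ n →
    (∀ (i j : Fin (suc l)) → i <ᶠ j → m j < m i) →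
    m (fromℕ l) ≡ 1 →
    (s t : ℕ) → s < t → t ≤ n →
    (S : Subset n) → ∣ S ∣ ≡ s →
    Σ (List (Subset n)) (λ As → All (InQ n l m) As × ∣ S ∪ ⋃ As ∣ ≡ t)
mainTheorem3 n l m _ 1≤m _ _ m-last≡1 s t s<t t≤n S refl
  with augmentsByOne⇒augments (q-augmentsByOne n l m 1≤m m-last≡1) (t ∸ s) S
         (subst (_≤ n) (sym (m∸n+n≡m (<⇒≤ s<t))) t≤n)
... | As , As∈q , ∣S∪⋃As∣ = As , As∈q , trans ∣S∪⋃As∣ (m∸n+n≡m (<⇒≤ s<t))
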